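{- Let $G$ be an unweighted undirected $n$-vertex graph, $f\ge 1$ an integer and $p>0$ a parameter. Run the following algorithm. Initially every vertex is colored white and has $\mathrm{counter}(v)=f+1$; $S=\emptyset$, $E'=\emptyset$. While there exists a vertex $s\in V\setminus S$ having at least $p$ white neighbors: add $s$ to $S$ and color $s$ red; for each white neighbor $u$ of $s$, decrement $\mathrm{counter}(u)$, add the edge $(s,u)$ to $E'$, and if $\mathrm{counter}(u)=0$ color $u$ black. After the loop, add to $E'$ every edge of $G$ having at least one endpoint colored white. Finally let $A_S$ be a $\beta$-additive $f$-EFT (resp. $f$-VFT) sourcewise spanner of $G$ with respect to $S$, and return $H=(V(G),E'\cup E(A_S))$. Then $H$ is a $(\beta+2)$-additive $f$-EFT (resp. $f$-VFT) spanner of $G$.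
   Context: $d_X(u,v)$ is the shortest-path distance in graph $X$; for a set $F$ of edges (resp. vertices), $X-F$ is obtained by removing the edges in $F$ (resp. the vertices in $F$ and their incident edges). A subgraph $A_S$ is a $\beta$-additive $f$-EFT (resp. $f$-VFT) sourcewise spanner w.r.t. $S$ if for every set $F$ of at most $f$ edges (resp. vertices), $d_{A_S-F}(s,t)\le d_{G-F}(s,t)+\beta$ for all $s\in S$, $t\in V(G)$. A spanning subgraph $H$ is a $\gamma$-additive $f$-EFT (resp. $f$-VFT) spanner if for every set $F$ of at most $f$ edges (resp. vertices), $d_{H-F}(s,t)\le d_{G-F}(s,t)+\gamma$ for all $s,t$ (trivially satisfied if $d_{G-F}(s,t)=\infty$). -}

module Defs where

open import Data.Nat using (ℕ; zero; suc; _+_; _≤_; _<_; pred; _≡ᵇ_)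
open import Data.Bool using (Bool; true; false; _∧_; _∨_; if_then_else_)
open import Data.Fin using (Fin; _≟_)
open import Data.Vec using (countᵇ; allFin)
open import Data.List using (List; length)
open import Data.List.Relation.Unary.All using (All)
open import Data.List.Membership.Propositional using (_∈_; _∉_)
open import Data.Product using (Σ; Σ-syntax; _×_; _,_; proj₁; proj₂)
open import Data.Sum using (_⊎_)
open import Data.Unit using (⊤)
open import Relation.Nullary using (¬_)
open import Relation.Nullary.Decidable using (⌊_⌋)
open import Relation.Binary.PropositionalEquality using (_≡_)

record Graph (n : ℕ) : Set where
  field
    adj    : Fin n → Fin n → Bool
    sym    : ∀ u v → adj u v ≡ adj v u
    irrefl : ∀ u → adj u u ≡ false

open Graph public

Edge : ∀ {n} → Graph n → Fin n → Fin n → Set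
Edge G u v = adj G u v ≡ true

AdjRel : ℕ → Set₁
AdjRel n = Fin n → Fin n → Set

IsSubgraph : ∀ {n} → Graph n → AdjRel n → Set
IsSubgraph G X = (∀ u v → X u v → Edge G u v) × (∀ u v → X u v → X v u)

data Mode : Set where
  EFT VFT : Mode

Faults : ∀ {n} → Graph n → Mode → ℕ → Set
Faults {n} G EFT f =
  Σ[ F ∈ List (Fin n × Fin n) ] (length F ≤ f × All (λ e → Edge G (proj₁ e) (proj₂ e)) F)
Faults {n} G VFT f = Σ[ F ∈ List (Fin n) ] (length F ≤ f)

Alive : ∀ {n} {G : Graph n} (m : Mode) {f : ℕ} → Faults G m f → Fin n → Set
Alive EFT F v = ⊤
Alive VFT F v = v ∉ proj₁ F

Minus : ∀ {n} {G : Graph n} (m : Mode) {f : ℕ} → AdjRel n → Faults G m f → AdjRel n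
Minus EFT X F u v = X u v × ¬ ((u , v) ∈ proj₁ F) × ¬ ((v , u) ∈ proj₁ F)
Minus VFT X F u v = X u v × u ∉ proj₁ F × v ∉ proj₁ F

data Walk {n : ℕ} (ok : Fin n → Set) (X : AdjRel n) : Fin n → Fin n → ℕ → Set where
  nil  : ∀ {u} → ok u → Walk ok X u u zero
  cons : ∀ {u v w k} → ok u → X u v → Walk ok X v w k → Walk ok X u w (suc k)

-- d_{X-F}(s,t) ≤ d_{G-F}(s,t) + β, with the convention that it holds
-- trivially when d_{G-F}(s,t) = ∞: every s-t walk of length k in G-F is
-- matched by an s-t walk of length ≤ k + β in X-F.
DistBound : ∀ {n} (G : Graph n) (m : Mode) {f : ℕ} (F : Faults G m f)
            (X : AdjRel n) (β : ℕ) (s t : Fin n) → Set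
DistBound G m F X β s t =
  ∀ k → Walk (Alive m F) (Minus m (Edge G) F) s t k →
    Σ[ k' ∈ ℕ ] (k' ≤ k + β × Walk (Alive m F) (Minus m X F) s t k')

SourcewiseSpanner : ∀ {n} (G : Graph n) (m : Mode) (f β : ℕ)
                    (S : Fin n → Bool) (A : AdjRel n) → Set
SourcewiseSpanner {n} G m f β S A =
  IsSubgraph G A ×
  (∀ (F : Faults G m f) (s : Fin n) → S s ≡ true → ∀ t → DistBound G m F A β s t)

Spanner : ∀ {n} (G : Graph n) (m : Mode) (f γ : ℕ) (H : AdjRel n) → Set
Spanner {n} G m f γ H =
  IsSubgraph G H × (∀ (F : Faults G m f) (s t : Fin n) → DistBound G m F H γ s t)

data Color : Set where
  white red black : Color

isWhite : Color → Bool
isWhite white = true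
isWhite red   = false
isWhite black = false

record State (n : ℕ) : Set where
  field
    color   : Fin n → Color
    counter : Fin n → ℕ
    inS     : Fin n → Bool
    E'      : Fin n → Fin n → Bool

open State public

initState : ∀ {n} → ℕ → State n
initState f = record
  { color   = λ _ → white
  ; counter = λ _ → suc f
  ; inS     = λ _ → false
  ; E'      = λ _ _ → false
  }

isWN : ∀ {n} → Graph n → State n → Fin n → Fin n → Bool
isWN G st s u = adj G s u ∧ isWhite (color st u)

numWhite : ∀ {n} → Graph n → State n → Fin n → ℕ
numWhite {n} G st s = countᵇ (isWN G st s) (allFin n)

eqF : ∀ {n} → Fin n → Fin n → Bool
eqF u v = ⌊ u ≟ v ⌋

step : ∀ {n} → Graph n → State n → Fin n → State n
step G st s = record
  { color   = λ u → if eqF u s then red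
                    else if isWN G st s u
                         then (if newCounter u ≡ᵇ 0 then black else color st u)
                         else color st u
  ; counter = newCounter
  ; inS     = λ u → eqF u s ∨ inS st u
  ; E'      = λ u v → E' st u v ∨ (eqF u s ∧ isWN G st s v) ∨ (eqF v s ∧ isWN G st s u)
  }
  where
  newCounter : _ → ℕ
  newCounter u = if isWN G st s u then pred (counter st u) else counter st u

-- Exec G p st st' : some run of the while loop from st reaches st'
-- (any choice of s satisfying the loop condition is allowed).
data Exec {n : ℕ} (G : Graph n) (p : ℕ) : State n → State n → Set where
  done : ∀ {st} → Exec G p st st
  next : ∀ {st st'} (s : Fin n) → inS st s ≡ false → p ≤ numWhite G st s →
         Exec G p (step G st s) st' → Exec G p st st'

Terminal : ∀ {n} → Graph n → ℕ → State n → Set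
Terminal G p st = ∀ s → inS st s ≡ false → numWhite G st s < p

finalE' : ∀ {n} → Graph n → State n → Fin n → Fin n → Bool
finalE' G st u v = E' st u v ∨ (adj G u v ∧ (isWhite (color st u) ∨ isWhite (color st v)))

outputH : ∀ {n} → Graph n → State n → AdjRel n → AdjRel n
outputH G st A u v = (finalE' G st u v ≡ true) ⊎ A u v

-- Every G-edge at a white vertex is in H, and a vertex that is not white is either red (a source)
-- or black, in which case E' joins it to f + 1 distinct sources.  So a walk P from s to t in
-- G - F splits at its last non-white vertex y (after s) into P[s..y] and a tail lying in H - F.
-- If y is red, A_S - F has a y-s walk of length at most |P[s..y]| + β.  If y is black, F blocks
-- at most f of its f + 1 sources, so the edge x-y to some source x survives in G - F and H - F;
-- then A_S - F has an x-s walk of length at most |P[s..y]| + 1 + β, and x-y followed by the tail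
-- reaches t: the edge x-y is paid twice, whence β + 2.
module Submission where

open import Defs
open import Data.Nat using (ℕ; zero; suc; pred; _≤_; _<_; _+_; s≤s; s≤s⁻¹)
open import Data.Nat.Properties using (≤-refl; ≤-trans; ≤-reflexive; <-≤-trans; m≤m+n; n≤1+n; +-suc; +-identityʳ; +-monoˡ-≤)
open import Data.Nat.Tactic.RingSolver using (solve-∀)
open import Data.Bool using (true; false; _∧_; _∨_)
open import Data.Bool.Properties using (∨-comm; ∨-zeroʳ)
open import Data.Fin using (Fin; _≟_)
open import Data.List using (List; []; _∷_; length; map; filter)
open import Data.List.Properties using (length-map; filter-notAll)
open import Data.List.Relation.Unary.All as All using (All; []; _∷_)
open import Data.List.Relation.Unary.Any as Any using (here; there)
open import Data.List.Relation.Unary.AllPairs using ([]; _∷_)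
open import Data.List.Relation.Unary.Unique.Propositional using (Unique)
open import Data.List.Membership.Propositional using (_∈_; _∉_)
open import Data.List.Membership.Propositional.Properties using (∈-map⁺; ∈-filter⁺)
open import Data.List.Membership.DecPropositional using (_∈?_)
open import Data.Product using (Σ-syntax; ∃-syntax; _×_; _,_; proj₁; proj₂)
open import Data.Sum using (_⊎_; inj₁; inj₂)
open import Data.Empty using (⊥-elim)
open import Data.Unit using (tt)
open import Function using (case_of_)
open import Relation.Nullary using (yes; no; ¬?)
open import Relation.Binary.Definitions using (DecidableEquality)
open import Relation.Binary.PropositionalEquality as ≡ using (_≡_; _≢_; refl; trans; cong; cong₂; subst)

∨-true-resp : ∀ {a a' b b'} → (a ≡ true → a' ≡ true) → b ≡ b' → a ∨ b ≡ true → a' ∨ b' ≡ true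
∨-true-resp {true}  a⇒a' refl _ rewrite a⇒a' refl = refl
∨-true-resp {false} {a'} _ refl b rewrite b = ∨-zeroʳ a'

+-pred-≤ : ∀ l c → l + c ≤ suc l + pred c
+-pred-≤ l zero    = n≤1+n (l + 0)
+-pred-≤ l (suc c) = ≤-reflexive (+-suc l c)

+-detour-red : ∀ a b β → a + β + b + 2 ≡ a + b + (β + 2)
+-detour-red = solve-∀

+-detour-black : ∀ a b β → suc a + β + suc b ≡ a + b + (β + 2)
+-detour-black = solve-∀

module _ {n : ℕ} {ok : Fin n → Set} where

  ok-start : ∀ {X : AdjRel n} {u v k} → Walk ok X u v k → ok u
  ok-start (nil o)      = o
  ok-start (cons o _ _) = o

  mapʷ : ∀ {X Y : AdjRel n} → (∀ {u v} → X u v → Y u v) → ∀ {u v k} → Walk ok X u v k → Walk ok Y u v k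
  mapʷ g (nil o)      = nil o
  mapʷ g (cons o e w) = cons o (g e) (mapʷ g w)

  _++ʷ_ : ∀ {X : AdjRel n} {u v w a b} → Walk ok X u v a → Walk ok X v w b → Walk ok X u w (a + b)
  nil _      ++ʷ w' = w'
  cons o e w ++ʷ w' = cons o e (w ++ʷ w')

  snocʷ : ∀ {X : AdjRel n} {u v w k} → Walk ok X u v k → X v w → ok w → Walk ok X u w (suc k)
  snocʷ (nil o)      e' o' = cons o e' (nil o')
  snocʷ (cons o e w) e' o' = cons o e (snocʷ w e' o')

  reverseʷ : ∀ {X : AdjRel n} → (∀ {u v} → X u v → X v u) → ∀ {u v k} → Walk ok X u v k → Walk ok X v u k
  reverseʷ X-sym (nil o)      = nil o
  reverseʷ X-sym (cons o e w) = snocʷ (reverseʷ X-sym w) (X-sym e) o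

module _ {n} {G : Graph n} (m : Mode) {f} (F : Faults G m f) where

  Minus-map : ∀ {X Y : AdjRel n} {u v} → (X u v → Y u v) → Minus m X F u v → Minus m Y F u v
  Minus-map {X} {Y} {u} {v} g = go m F
    where
    go : (m' : Mode) (F' : Faults G m' f) → Minus m' X F' u v → Minus m' Y F' u v
    go EFT _ (x , a , b) = g x , a , b
    go VFT _ (x , a , b) = g x , a , b

  Minus-sym : ∀ {X : AdjRel n} → (∀ u v → X u v → X v u) → ∀ {u v} → Minus m X F u v → Minus m X F v u
  Minus-sym {X} X-sym = go m F
    where
    go : (m' : Mode) (F' : Faults G m' f) → ∀ {u v} → Minus m' X F' u v → Minus m' X F' v u
    go EFT _ {u} {v} (x , a , b) = X-sym u v x , b , a
    go VFT _ {u} {v} (x , a , b) = X-sym u v x , b , a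

module _ {A : Set} (_≟ᴬ_ : DecidableEquality A) where

  ∃∉-of-length< : ∀ {L : List A} xs → Unique L → length xs < length L → ∃[ y ] (y ∈ L × y ∉ xs)
  ∃∉-of-length< {x ∷ L} xs (x∉L ∷ L-unique) |xs|<|L| with _∈?_ _≟ᴬ_ x xs
  ... | no x∉xs = x , here refl , x∉xs
  ... | yes x∈xs with ∃∉-of-length< (filter (λ z → ¬? (z ≟ᴬ x)) xs) L-unique shorter
    where
    shorter = <-≤-trans (filter-notAll (λ z → ¬? (z ≟ᴬ x)) xs (Any.map (λ { refl z≢z → z≢z refl }) x∈xs))
                        (s≤s⁻¹ |xs|<|L|)
  ... | y , y∈L , y∉xs' =
    y , there y∈L , λ y∈xs → y∉xs' (∈-filter⁺ (λ z → ¬? (z ≟ᴬ x)) y∈xs λ { refl → All.lookup x∉L y∈L refl })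

eqF-refl : ∀ {n} (x : Fin n) → eqF x x ≡ true
eqF-refl x with x ≟ x
... | yes _  = refl
... | no x≢x = ⊥-elim (x≢x refl)

isWN⇒ : ∀ {n} (G : Graph n) st s u → isWN G st s u ≡ true → Edge G s u × color st u ≡ white
isWN⇒ G st s u w with adj G s u | color st u
... | true | white = refl , refl
isWN⇒ G st s u () | true  | red
isWN⇒ G st s u () | true  | black
isWN⇒ G st s u () | false | _

-- Each decrement of counter(u) comes with a new source joined to u in E', so the number of such
-- sources plus counter(u) never drops below f + 1.
record LoopInvariant {n} (G : Graph n) (f : ℕ) (st : State n) : Set where
  field
    red⇒inS    : ∀ u → color st u ≡ red → inS st u ≡ true
    black⇒zero : ∀ u → color st u ≡ black → counter st u ≡ 0
    E'-sym     : ∀ u v → E' st u v ≡ true → E' st v u ≡ true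
    E'⊆G       : ∀ u v → E' st u v ≡ true → Edge G u v
    sources    : ∀ u → Σ[ L ∈ List (Fin n) ] (Unique L ×
                   All (λ s → inS st s ≡ true × E' st s u ≡ true) L × suc f ≤ length L + counter st u)
open LoopInvariant

loopInvariant-init : ∀ {n} (G : Graph n) f → LoopInvariant G f (initState f)
loopInvariant-init G f = record
  { red⇒inS    = λ _ ()
  ; black⇒zero = λ _ ()
  ; E'-sym     = λ _ _ ()
  ; E'⊆G       = λ _ _ ()
  ; sources    = λ _ → [] , [] , [] , ≤-refl
  }

module _ {n} (G : Graph n) (f : ℕ) (st : State n) (s : Fin n) (s∉S : inS st s ≡ false)
         (I : LoopInvariant G f st) where

  private
    st' = step G st s

  step-red⇒inS : ∀ u → color st' u ≡ red → inS st' u ≡ true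
  step-red⇒inS u c with u ≟ s
  ... | yes _ = refl
  ... | no _ with isWN G st s u
  ... | false = red⇒inS I u c
  ... | true with pred (counter st u)
  step-red⇒inS u () | no _ | true | zero
  ... | suc _ = red⇒inS I u c

  step-black⇒zero : ∀ u → color st' u ≡ black → counter st' u ≡ 0
  step-black⇒zero u c with u ≟ s
  step-black⇒zero u () | yes _
  ... | no _ with isWN G st s u in w
  ... | false = black⇒zero I u c
  ... | true with pred (counter st u)
  ... | zero  = refl
  ... | suc _ with () ← trans (≡.sym c) (proj₂ (isWN⇒ G st s u w))

  step-E'-sym : ∀ u v → E' st' u v ≡ true → E' st' v u ≡ true
  step-E'-sym u v = ∨-true-resp (E'-sym I u v) (∨-comm (eqF u s ∧ isWN G st s v) (eqF v s ∧ isWN G st s u))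

  step-E'⁻ : ∀ u v → E' st' u v ≡ true →
    E' st u v ≡ true ⊎ (u ≡ s × isWN G st s v ≡ true) ⊎ (v ≡ s × isWN G st s u ≡ true)
  step-E'⁻ u v e with E' st u v | u ≟ s | isWN G st s v | v ≟ s | isWN G st s u
  ... | true  | _       | _     | _       | _    = inj₁ refl
  ... | false | yes u≡s | true  | _       | _    = inj₂ (inj₁ (u≡s , refl))
  ... | false | yes _   | false | yes v≡s | true = inj₂ (inj₂ (v≡s , refl))
  ... | false | no _    | _     | yes v≡s | true = inj₂ (inj₂ (v≡s , refl))
  step-E'⁻ u v () | false | yes _ | false | yes _ | false
  step-E'⁻ u v () | false | yes _ | false | no _  | _
  step-E'⁻ u v () | false | no _  | _     | yes _ | false
  step-E'⁻ u v () | false | no _  | _     | no _  | _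

  step-E'⊆G : ∀ u v → E' st' u v ≡ true → Edge G u v
  step-E'⊆G u v e with step-E'⁻ u v e
  ... | inj₁ old               = E'⊆G I u v old
  ... | inj₂ (inj₁ (refl , w)) = proj₁ (isWN⇒ G st s v w)
  ... | inj₂ (inj₂ (refl , w)) = trans (Graph.sym G u v) (proj₁ (isWN⇒ G st s u w))

  still-source : ∀ {x u b} → inS st x ≡ true × E' st x u ≡ true → eqF x s ∨ inS st x ≡ true × E' st x u ∨ b ≡ true
  still-source (x∈S , xE'u) rewrite x∈S | xE'u = ∨-zeroʳ _ , refl

  step-sources : ∀ u → Σ[ L ∈ List (Fin n) ] (Unique L ×
                   All (λ x → inS st' x ≡ true × E' st' x u ≡ true) L × suc f ≤ length L + counter st' u)
  step-sources u with sources I u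
  ... | L , L-unique , L-sources , bound with isWN G st s u in w
  ... | false = L , L-unique , All.map still-source L-sources , bound
  ... | true  = s ∷ L , All.map s∉L L-sources ∷ L-unique , s-source ∷ All.map still-source L-sources
              , ≤-trans bound (+-pred-≤ (length L) (counter st u))
    where
    s∉L : ∀ {x} → inS st x ≡ true × E' st x u ≡ true → s ≢ x
    s∉L (x∈S , _) refl with () ← trans (≡.sym s∉S) x∈S
    s-source : ∀ {b} → eqF s s ∨ inS st s ≡ true × E' st s u ∨ (eqF s s ∧ true) ∨ b ≡ true
    s-source rewrite eqF-refl s = refl , ∨-zeroʳ (E' st s u)

  step-preserves : LoopInvariant G f st'
  step-preserves = record
    { red⇒inS    = step-red⇒inS
    ; black⇒zero = step-black⇒zero
    ; E'-sym     = step-E'-sym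
    ; E'⊆G       = step-E'⊆G
    ; sources    = step-sources
    }

black⇒many-sources : ∀ {n} {G : Graph n} {f st} → LoopInvariant G f st → ∀ {y} → color st y ≡ black →
  Σ[ L ∈ List (Fin n) ] (Unique L × All (λ s → inS st s ≡ true × E' st s y ≡ true) L × suc f ≤ length L)
black⇒many-sources {st = st} I {y} y-black with sources I y
... | L , L-unique , L-sources , bound =
  L , L-unique , L-sources , subst (_ ≤_) (trans (cong (length L +_) (black⇒zero I y y-black)) (+-identityʳ _)) bound

Exec-preserves : ∀ {n} {G : Graph n} {p f st st'} → LoopInvariant G f st → Exec G p st st' → LoopInvariant G f st'
Exec-preserves I done                             = I
Exec-preserves {G = G} {f = f} I (next s s∉S _ r) = Exec-preserves (step-preserves G f _ s s∉S I) r

otherEnd : ∀ {n} → Fin n → Fin n × Fin n → Fin n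
otherEnd y (a , b) with a ≟ y
... | yes _ = b
... | no _  = a

otherEnd-ʳ : ∀ {n} {s y : Fin n} → s ≢ y → otherEnd y (s , y) ≡ s
otherEnd-ʳ {s = s} {y} s≢y with s ≟ y
... | yes s≡y = ⊥-elim (s≢y s≡y)
... | no _    = refl

otherEnd-ˡ : ∀ {n} {s y : Fin n} → otherEnd y (y , s) ≡ s
otherEnd-ˡ {y = y} with y ≟ y
... | yes _  = refl
... | no y≢y = ⊥-elim (y≢y refl)

module _ {n} {G : Graph n} where

  -- the vertices x for which a fault of F hits x itself or the edge x–y
  blockers : (m : Mode) {f : ℕ} → Fin n → Faults G m f → List (Fin n)
  blockers EFT y (F , _) = map (otherEnd y) F
  blockers VFT y (F , _) = F

  length-blockers : (m : Mode) {f : ℕ} (y : Fin n) (F : Faults G m f) → length (blockers m y F) ≤ f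
  length-blockers EFT y (F , |F|≤f , _) = ≤-trans (≤-reflexive (length-map (otherEnd y) F)) |F|≤f
  length-blockers VFT y (F , |F|≤f)     = |F|≤f

  unblocked-edge : (m : Mode) {f : ℕ} (F : Faults G m f) {X : AdjRel n} {x y : Fin n} →
    x ≢ y → Alive m F y → x ∉ blockers m y F → X x y → Alive m F x × Minus m X F x y
  unblocked-edge EFT (F , _) {y = y} x≢y _ x∉B e =
    tt , e , (λ xy∈F → x∉B (subst (_∈ _) (otherEnd-ʳ x≢y) (∈-map⁺ (otherEnd y) xy∈F)))
           , (λ yx∈F → x∉B (subst (_∈ _) (otherEnd-ˡ {y = y}) (∈-map⁺ (otherEnd y) yx∈F)))
  unblocked-edge VFT F       _   y∉F x∉F e = x∉F , e , x∉F , y∉F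

module Stretch {n} (G : Graph n) (m : Mode) (f β : ℕ) (st : State n) (I : LoopInvariant G f st)
               (A : AdjRel n) (A-spanner : SourcewiseSpanner G m f β (inS st) A) (F : Faults G m f) where

  private
    H   = outputH G st A
    ok  = Alive m F
    G-F = Minus m (Edge G) F
    H-F = Minus m H F

  reverse-G-F : ∀ {u v k} → Walk ok G-F u v k → Walk ok G-F v u k
  reverse-G-F = reverseʷ (Minus-sym m F λ u v e → trans (Graph.sym G v u) e)

  E'⊆H : ∀ {u v} → E' st u v ≡ true → H u v
  E'⊆H e rewrite e = inj₁ refl

  white-edge⊆H : ∀ {u v} → Edge G u v → color st v ≡ white → H u v
  white-edge⊆H {u} {v} e c rewrite e | c | ∨-zeroʳ (isWhite (color st u)) = inj₁ (∨-zeroʳ (E' st u v))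

  split-at-last-nonwhite : ∀ {u t k} → Walk ok G-F u t k → Walk ok H-F u t k ⊎
    Σ[ y ∈ Fin n ] Σ[ a ∈ ℕ ] Σ[ b ∈ ℕ ]
      (color st y ≢ white × k ≡ a + b × Walk ok G-F u y a × Walk ok H-F y t b)
  split-at-last-nonwhite (nil o) = inj₁ (nil o)
  split-at-last-nonwhite (cons {v = v} o e P) with split-at-last-nonwhite P
  ... | inj₂ (y , a , b , y≢white , refl , g , h) = inj₂ (y , suc a , b , y≢white , refl , cons o e g , h)
  ... | inj₁ h with color st v in c
  ... | white = inj₁ (cons o (Minus-map m F (λ e → white-edge⊆H e c) e) h)
  ... | red   = inj₂ (v , 1 , _ , (λ w → case trans (≡.sym c) w of λ ()) , refl , cons o e (nil (ok-start h)) , h)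
  ... | black = inj₂ (v , 1 , _ , (λ w → case trans (≡.sym c) w of λ ()) , refl , cons o e (nil (ok-start h)) , h)

  black⇒source-neighbour : ∀ {y} → ok y → color st y ≡ black →
    Σ[ x ∈ Fin n ] (inS st x ≡ true × ok x × G-F x y × H-F x y)
  black⇒source-neighbour {y} y-ok y-black with black⇒many-sources I y-black
  ... | L , L-unique , L-sources , f<|L|
    with ∃∉-of-length< _≟_ (blockers m y F) L-unique (<-≤-trans (s≤s (length-blockers m y F)) f<|L|)
  ... | x , x∈L , x∉B with All.lookup L-sources x∈L
  ... | x∈S , xE'y = x , x∈S , proj₁ G-edge , proj₂ G-edge , proj₂ (unblocked-edge m F x≢y y-ok x∉B (E'⊆H xE'y))
    where
    xy∈G = E'⊆G I x y xE'y
    x≢y : x ≢ y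
    x≢y refl with () ← trans (≡.sym xy∈G) (Graph.irrefl G x)
    G-edge = unblocked-edge m F x≢y y-ok x∉B xy∈G

  via-source : ∀ {x s₀ t a b} → inS st x ≡ true → Walk ok G-F x s₀ a → Walk ok H-F x t b →
    Σ[ k ∈ ℕ ] (k ≤ a + β + b × Walk ok H-F s₀ t k)
  via-source {b = b} x∈S g h with proj₂ A-spanner F _ x∈S _ _ g
  ... | a' , a'≤a+β , wA =
    a' + b , +-monoˡ-≤ _ a'≤a+β , mapʷ (Minus-map m F inj₂) (reverseʷ (Minus-sym m F A-sym) wA) ++ʷ h
    where A-sym = proj₂ (proj₁ A-spanner)

  stretch : ∀ s₀ t → DistBound G m F H (β + 2) s₀ t
  stretch s₀ t k P with split-at-last-nonwhite P
  ... | inj₁ h = k , m≤m+n k (β + 2) , h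
  ... | inj₂ (y , a , b , y≢white , refl , g , h) with color st y in c
  ... | white = ⊥-elim (y≢white refl)
  ... | red with via-source (red⇒inS I y c) (reverse-G-F g) h
  ...   | k' , k'≤ , w = k' , ≤-trans k'≤ (≤-trans (m≤m+n _ 2) (≤-reflexive (+-detour-red a b β))) , w
  stretch s₀ t k P | inj₂ (y , a , b , _ , refl , g , h) | black with black⇒source-neighbour (ok-start h) c
  ... | x , x∈S , x-ok , xy∈G-F , xy∈H-F
    with via-source x∈S (cons x-ok xy∈G-F (reverse-G-F g)) (cons x-ok xy∈H-F h)
  ... | k' , k'≤ , w = k' , ≤-trans k'≤ (≤-reflexive (+-detour-black a b β)) , w

outputH-subgraph : ∀ {n} {G : Graph n} {f st} → LoopInvariant G f st → ∀ {A} → IsSubgraph G A →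
  IsSubgraph G (outputH G st A)
outputH-subgraph {G = G} {st = st} I {A} (A⊆G , A-sym) = H⊆G , H-sym
  where
  H⊆G : ∀ u v → outputH G st A u v → Edge G u v
  H⊆G u v (inj₂ e) = A⊆G u v e
  H⊆G u v (inj₁ e) with E' st u v in e'
  ... | true = E'⊆G I u v e'
  ... | false with adj G u v
  ... | true = refl
  H⊆G u v (inj₁ ()) | false | false
  H-sym : ∀ u v → outputH G st A u v → outputH G st A v u
  H-sym u v (inj₂ e) = inj₂ (A-sym u v e)
  H-sym u v (inj₁ e) = inj₁ (∨-true-resp (E'-sym I u v)
    (cong₂ _∧_ (Graph.sym G u v) (∨-comm (isWhite (color st u)) (isWhite (color st v)))) e)

theorem2 : ∀ {n : ℕ} (G : Graph n) (m : Mode) (f p β : ℕ) → 1 ≤ f → 1 ≤ p →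
    (st : State n) → Exec G p (initState f) st → Terminal G p st →
    (A : AdjRel n) → SourcewiseSpanner G m f β (inS st) A →
    Spanner G m f (β + 2) (outputH G st A)
theorem2 G m f p β _ _ st run _ A A-spanner =
  outputH-subgraph I (proj₁ A-spanner) , λ F → Stretch.stretch G m f β st I A A-spanner F
  where
  I = Exec-preserves (loopInvariant-init G f) run
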